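{- Let $\Gamma$ be an infinite torsion-free Abelian group and let $T$ be a tree of diameter $5$ with central vertices $v_{c_1},v_{c_2}$ such that $v_{c_1}\in\Omega_{\mathfrak{s}}(T)\cup\Omega_{\mathfrak{w}}(T)$ and $v_{c_2}\notin\Omega_{\mathfrak{s}}(T)\cup\Omega_{\mathfrak{w}}(T)$. Then $T$ is not $\Gamma$-vertex magic.
   Context: Graphs are finite, simple and undirected. For an additive Abelian group $\Gamma$ with identity $0$ and a graph $G$, a $\Gamma$-vertex magic labeling is a map $\ell:V(G)\to\Gamma\setminus\{0\}$ for which there is $\mu\in\Gamma$ with $w(v)=\sum_{u\in N(v)}\ell(u)=\mu$ for every vertex $v$; $G$ is $\Gamma$-vertex magic if it has such a labeling. A pendant vertex has degree $1$. $\Omega_{\mathfrak{s}}(T)$ is the set of strong support vertices (adjacent to at least two pendant vertices) and $\Omega_{\mathfrak{w}}(T)$ the set of weak support vertices (adjacent to exactly one pendant vertex). A tree of diameter $5$ has two adjacent central vertices $v_{c_1},v_{c_2}$, the two middle vertices of any longest path. A torsion-free group has only $0$ as element of finite order. -}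

module Defs where

open import Level using (Level; _⊔_)
open import Data.Nat using (ℕ; zero; suc; _+_; _≤_; _≡ᵇ_)
open import Data.Bool using (Bool; true; false; _∧_; if_then_else_)
open import Data.Fin using (Fin; zero; suc; fromℕ; inject₁)
open import Data.Product using (Σ; ∃; ∃-syntax; _×_; _,_)
open import Data.Sum using (_⊎_)
open import Relation.Nullary using (¬_)
open import Relation.Binary.PropositionalEquality using (_≡_)
open import Function.Definitions using (Injective)
open import Algebra.Bundles using (AbelianGroup)

record Graph : Set where
  field
    n     : ℕ
    adj   : Fin n → Fin n → Bool
    sym   : ∀ u v → adj u v ≡ adj v u
    irrefl : ∀ v → adj v v ≡ false

module _ (G : Graph) where
  open Graph G

  count : ∀ {m} → (Fin m → Bool) → ℕ
  count {zero}  p = 0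
  count {suc m} p = (if p zero then 1 else 0) + count (λ i → p (suc i))

  degree : Fin n → ℕ
  degree v = count (adj v)

  isPendant : Fin n → Bool
  isPendant v = degree v ≡ᵇ 1

  pendantNbrs : Fin n → ℕ
  pendantNbrs v = count (λ u → adj v u ∧ isPendant u)

  -- Ω_s : strong support vertices (adjacent to at least two pendant vertices)
  StrongSupport : Fin n → Set
  StrongSupport v = 2 ≤ pendantNbrs v

  -- Ω_w : weak support vertices (adjacent to exactly one pendant vertex)
  WeakSupport : Fin n → Set
  WeakSupport v = pendantNbrs v ≡ 1

  record Path (u v : Fin n) (k : ℕ) : Set where
    field
      vtx   : Fin (suc k) → Fin n
      inj   : Injective _≡_ _≡_ vtx
      start : vtx zero ≡ u
      end   : vtx (fromℕ k) ≡ v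
      step  : ∀ (i : Fin k) → adj (vtx (inject₁ i)) (vtx (suc i)) ≡ true

  record Cycle : Set where
    field
      len   : ℕ
      len≥2 : 2 ≤ len
      a b   : Fin n
      path  : Path a b len
      close : adj b a ≡ true

  Connected : Set
  Connected = ∀ u v → ∃[ k ] Path u v k

  Acyclic : Set
  Acyclic = ¬ Cycle

  IsTree : Set
  IsTree = Connected × Acyclic

  Dist : Fin n → Fin n → ℕ → Set
  Dist u v k = Path u v k × (∀ j → Path u v j → k ≤ j)

  Diameter : ℕ → Set
  Diameter d = (∃[ u ] ∃[ v ] Dist u v d) × (∀ u v k → Dist u v k → k ≤ d)

  -- c1, c2 are the central vertices of a diameter-5 tree: the two middle
  -- vertices (positions 2 and 3) of a longest path v0 … v5
  CentralPair : Fin n → Fin n → Set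
  CentralPair c1 c2 =
    ∃[ x ] ∃[ y ] Σ (Path x y 5) λ p →
      Path.vtx p (suc (suc zero)) ≡ c1 × Path.vtx p (suc (suc (suc zero))) ≡ c2

module _ {c ℓ : Level} (A : AbelianGroup c ℓ) where
  open AbelianGroup A renaming (Carrier to Γ)

  times : ℕ → Γ → Γ
  times zero    x = ε
  times (suc m) x = x ∙ times m x

  TorsionFree : Set (c ⊔ ℓ)
  TorsionFree = ∀ (x : Γ) (m : ℕ) → times (suc m) x ≈ ε → x ≈ ε

  Infinite : Set (c ⊔ ℓ)
  Infinite = ¬ (∃[ k ] Σ (Fin k → Γ) λ f → ∀ x → ∃[ i ] f i ≈ x)

  sumFin : ∀ {m} → (Fin m → Γ) → Γ
  sumFin {zero}  f = ε
  sumFin {suc m} f = f zero ∙ sumFin (λ i → f (suc i))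

  module _ (G : Graph) where
    open Graph G

    weight : (Fin n → Γ) → Fin n → Γ
    weight lab v = sumFin (λ u → if adj v u then lab u else ε)

    IsVertexMagicLabeling : (Fin n → Γ) → Set (c ⊔ ℓ)
    IsVertexMagicLabeling lab =
      (∀ v → ¬ (lab v ≈ ε)) × (∃[ μ ] ∀ v → weight lab v ≈ μ)

    VertexMagic : Set (c ⊔ ℓ)
    VertexMagic = ∃[ lab ] IsVertexMagicLabeling lab

{-# OPTIONS --safe #-}
-- Let μ be the magic constant. A pendant vertex q has weight ℓ(s) for its support vertex s, so
-- ℓ(s) = μ for every support vertex, in particular ℓ(v_{c₁}) = μ. Every other neighbour u of
-- v_{c₂} is not pendant (v_{c₂} is not a support vertex), and every neighbour y ≠ v_{c₂} of u is
-- pendant, since otherwise a longest path could be lengthened to one of length 6; hence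
-- ℓ(u) = w(y) = μ as well. So μ = w(v_{c₂}) = deg(v_{c₂})·μ with deg(v_{c₂}) ≥ 2, and
-- torsion-freeness gives μ = 0 = ℓ(v_{c₁}), which is impossible.
module Submission where

open import Defs
open import Level using (Level)
open import Data.Fin using (Fin)
open import Data.Product using (_×_)
open import Data.Sum using (_⊎_)
open import Relation.Nullary using (¬_)
open import Algebra.Bundles using (AbelianGroup)

open import Data.Nat using (ℕ; zero; suc; pred; _≤_; z≤n; s≤s; _≡ᵇ_)
open import Data.Nat.Properties using (≡ᵇ⇒≡; ≤-reflexive; n≮n) renaming (_≟_ to _≟ℕ_)
open import Data.Fin using (zero; suc; fromℕ; inject₁)
open import Data.Fin.Properties using (_≟_; any?; suc-injective)
open import Data.Bool using (Bool; true; false; _∧_; if_then_else_; T)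
open import Data.Unit using (tt)
open import Data.Bool.Properties using (¬-not) renaming (_≟_ to _≟ᵇ_)
open import Data.Product using (∃-syntax; _,_)
open import Data.Sum using (inj₁; inj₂)
open import Data.Empty using (⊥-elim)
open import Data.List using (List; []; _∷_; length; lookup; tabulate)
open import Data.List.Properties using (length-tabulate)
open import Data.List.Membership.Propositional using (_∈_)
open import Data.List.Membership.Propositional.Properties using (∈-lookup)
open import Data.List.Relation.Binary.Subset.Propositional using (_⊆_)
open import Data.List.Relation.Binary.Subset.Propositional.Properties using (∷⁺ʳ)
open import Data.List.Relation.Unary.Any using (here; there)
open import Data.List.Relation.Unary.All as All using (All; []; _∷_)
open import Data.List.Relation.Unary.All.Properties using (anti-mono)
open import Data.List.Relation.Unary.AllPairs using ([]; _∷_)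
import Data.List.Relation.Unary.AllPairs.Properties as AllPairs
open import Data.List.Relation.Unary.Linked using (Linked; [-]; _∷_)
open import Data.List.Relation.Unary.Unique.Propositional using (Unique)
open import Function using (_∘_)
open import Function.Definitions using (Injective)
open import Relation.Nullary using (yes; no; ¬?)
open import Relation.Nullary.Decidable using (_×-dec_)
open import Relation.Binary.PropositionalEquality using (_≡_; _≢_; refl; sym; trans; cong; subst)

∧-≡true : ∀ {a b} → a ∧ b ≡ true → a ≡ true × b ≡ true
∧-≡true {true} {true} refl = refl , refl

module Counting (G : Graph) where

  count≡0⇒false : ∀ {m} (p : Fin m → Bool) → count G p ≡ 0 → ∀ u → p u ≡ false
  count≡0⇒false {suc m} p e u with p zero in p0
  count≡0⇒false {suc m} p () u       | true
  count≡0⇒false {suc m} p e zero    | false = p0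
  count≡0⇒false {suc m} p e (suc u) | false = count≡0⇒false (p ∘ suc) e u

  false⇒count≡0 : ∀ {m} (p : Fin m → Bool) → (∀ u → p u ≡ false) → count G p ≡ 0
  false⇒count≡0 {zero}  p h = refl
  false⇒count≡0 {suc m} p h rewrite h zero = false⇒count≡0 (p ∘ suc) (h ∘ suc)

  count≡suc⇒∃true : ∀ {m} (p : Fin m → Bool) {k} → count G p ≡ suc k → ∃[ u ] p u ≡ true
  count≡suc⇒∃true {suc m} p e with p zero in p0
  ... | true  = zero , p0
  ... | false with count≡suc⇒∃true (p ∘ suc) e
  ...   | u , pu = suc u , pu

  true⇒count≡suc : ∀ {m} (p : Fin m → Bool) {u} → p u ≡ true → ∃[ k ] count G p ≡ suc k
  true⇒count≡suc p {u} pu with count G p in e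
  ... | suc k = k , refl
  ... | zero with trans (sym pu) (count≡0⇒false p e u)
  ...   | ()

  true-at-two⇒count≡2+ : ∀ {m} (p : Fin m → Bool) {a b} → p a ≡ true → p b ≡ true → a ≢ b →
    ∃[ k ] count G p ≡ suc (suc k)
  true-at-two⇒count≡2+ p {zero}  {zero}  _  _  a≢b = ⊥-elim (a≢b refl)
  true-at-two⇒count≡2+ p {zero}  {suc b} pa pb _ rewrite pa with true⇒count≡suc (p ∘ suc) pb
  ... | k , e = k , cong suc e
  true-at-two⇒count≡2+ p {suc a} {zero}  pa pb _ rewrite pb with true⇒count≡suc (p ∘ suc) pa
  ... | k , e = k , cong suc e
  true-at-two⇒count≡2+ p {suc a} {suc b} pa pb a≢b
    with true-at-two⇒count≡2+ (p ∘ suc) pa pb (a≢b ∘ cong suc) | p zero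
  ... | k , e | true  = suc k , cong suc e
  ... | k , e | false = k , e

  count≡1⇒false-elsewhere : ∀ {m} (p : Fin m → Bool) {c} → count G p ≡ 1 → p c ≡ true →
    ∀ u → u ≢ c → p u ≡ false
  count≡1⇒false-elsewhere p e pc u u≢c with p u in pu
  ... | false = refl
  ... | true with true-at-two⇒count≡2+ p pu pc u≢c
  ...   | k , e′ with trans (sym e) e′
  ...     | ()

  false-elsewhere⇒count≡1 : ∀ {m} (p : Fin m → Bool) {c} → p c ≡ true →
    (∀ u → u ≢ c → p u ≡ false) → count G p ≡ 1
  false-elsewhere⇒count≡1 {suc m} p {zero} pc h rewrite pc =
    cong suc (false⇒count≡0 (p ∘ suc) (λ u → h (suc u) λ ()))
  false-elsewhere⇒count≡1 {suc m} p {suc c} pc h rewrite h zero (λ ()) =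
    false-elsewhere⇒count≡1 (p ∘ suc) pc (λ u u≢c → h (suc u) (u≢c ∘ suc-injective))

  count≢1⇒true-elsewhere : ∀ {m} (p : Fin m → Bool) {c} → p c ≡ true → count G p ≢ 1 →
    ∃[ u ] u ≢ c × p u ≡ true
  count≢1⇒true-elsewhere p {c} pc ≢1 with any? (λ u → ¬? (u ≟ c) ×-dec (p u ≟ᵇ true))
  ... | yes found = found
  ... | no none = ⊥-elim (≢1 (false-elsewhere⇒count≡1 p pc
                    λ u u≢c → ¬-not λ pu → none (u , u≢c , pu)))

module GroupSums {c ℓ : Level} (A : AbelianGroup c ℓ) where
  open AbelianGroup A renaming (Carrier to Γ; refl to ≈-refl; trans to ≈-trans)
  open import Algebra.Properties.Group group using (identityʳ-unique)

  sumFin-ε : ∀ {m} (f : Fin m → Γ) → (∀ u → f u ≈ ε) → sumFin A f ≈ ε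
  sumFin-ε {zero}  f h = ≈-refl
  sumFin-ε {suc m} f h = ≈-trans (∙-cong (h zero) (sumFin-ε (f ∘ suc) (h ∘ suc))) (identityˡ ε)

  sumFin-single : ∀ {m} (f : Fin m → Γ) c → (∀ u → u ≢ c → f u ≈ ε) → sumFin A f ≈ f c
  sumFin-single {suc m} f zero h =
    ≈-trans (∙-congˡ (sumFin-ε (f ∘ suc) (λ u → h (suc u) λ ()))) (identityʳ (f zero))
  sumFin-single {suc m} f (suc c) h =
    ≈-trans (∙-cong (h zero λ ()) (sumFin-single (f ∘ suc) c λ u u≢c → h (suc u) (u≢c ∘ suc-injective)))
          (identityˡ (f (suc c)))

  sumFin-masked-constant : (G : Graph) {m : ℕ} (p : Fin m → Bool) (g : Fin m → Γ) {μ : Γ} →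
    (∀ u → p u ≡ true → g u ≈ μ) → sumFin A (λ u → if p u then g u else ε) ≈ times A (count G p) μ
  sumFin-masked-constant G {zero}  p g h = ≈-refl
  sumFin-masked-constant G {suc m} p g h with p zero in p0
  ... | true  = ∙-cong (h zero p0) (sumFin-masked-constant G (p ∘ suc) (g ∘ suc) (h ∘ suc))
  ... | false = ≈-trans (identityˡ _) (sumFin-masked-constant G (p ∘ suc) (g ∘ suc) (h ∘ suc))

  torsionFree-fixed⇒ε : TorsionFree A → ∀ {μ} k → times A (suc (suc k)) μ ≈ μ → μ ≈ ε
  torsionFree-fixed⇒ε torsionFree {μ} k fixed = torsionFree μ k (identityʳ-unique μ _ fixed)

module _ {a} {A : Set a} where

  lastOf : A → List A → A
  lastOf x []       = x
  lastOf _ (y ∷ ys) = lastOf y ys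

  lastOf∈ : ∀ x ys → lastOf x ys ∈ x ∷ ys
  lastOf∈ x []       = here refl
  lastOf∈ x (y ∷ ys) = there (lastOf∈ y ys)

  lookup-last : ∀ x ys → lookup (x ∷ ys) (fromℕ (length ys)) ≡ lastOf x ys
  lookup-last x []       = refl
  lookup-last x (y ∷ ys) = lookup-last y ys

  lastOf-tabulate : ∀ {k} (f : Fin (suc k) → A) → lastOf (f zero) (tabulate (f ∘ suc)) ≡ f (fromℕ k)
  lastOf-tabulate {zero}  f = refl
  lastOf-tabulate {suc k} f = lastOf-tabulate (f ∘ suc)

  lookup-injective : ∀ {xs : List A} → Unique xs → Injective _≡_ _≡_ (lookup xs)
  lookup-injective {_ ∷ _} _         {zero}  {zero}  _ = refl
  lookup-injective         (x≢ ∷ _)  {zero}  {suc j} e = ⊥-elim (All.lookup x≢ (∈-lookup j) e)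
  lookup-injective         (x≢ ∷ _)  {suc i} {zero}  e = ⊥-elim (All.lookup x≢ (∈-lookup i) (sym e))
  lookup-injective         (_ ∷ u)   {suc i} {suc j} e = cong suc (lookup-injective u e)

  module _ {r} {R : A → A → Set r} where

    linked-lookup : ∀ {x xs} → Linked R (x ∷ xs) →
      ∀ (i : Fin (length xs)) → R (lookup (x ∷ xs) (inject₁ i)) (lookup (x ∷ xs) (suc i))
    linked-lookup (r ∷ _)  zero    = r
    linked-lookup (_ ∷ rs) (suc i) = linked-lookup rs i

    linked-tabulate : ∀ {k} (f : Fin (suc k) → A) → (∀ i → R (f (inject₁ i)) (f (suc i))) →
      Linked R (tabulate f)
    linked-tabulate {zero}  f _    = [-]
    linked-tabulate {suc k} f step = step zero ∷ linked-tabulate (f ∘ suc) (step ∘ suc)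

module SimplePaths (G : Graph) where
  open Graph G using (n; adj) renaming (sym to adj-sym; irrefl to adj-irrefl)

  infix 4 _~_
  _~_ : Fin n → Fin n → Set
  u ~ v = adj u v ≡ true

  ~-sym : ∀ {u v} → u ~ v → v ~ u
  ~-sym {u} {v} uv = trans (adj-sym v u) uv

  ~-irrefl : ∀ {u v} → u ~ v → u ≢ v
  ~-irrefl {u} uv refl with trans (sym uv) (adj-irrefl u)
  ... | ()

  SimplePath : List (Fin n) → Set
  SimplePath xs = Linked _~_ xs × Unique xs

  toPath : ∀ {x L} → SimplePath (x ∷ L) → Path G x (lastOf x L) (length L)
  toPath {x} {L} (linked , unique) = record
    { vtx   = lookup (x ∷ L)
    ; inj   = lookup-injective unique
    ; start = refl
    ; end   = lookup-last x L
    ; step  = linked-lookup linked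
    }

  fromPath : ∀ {u v k} → Path G u v k → ∃[ L ] SimplePath (u ∷ L) × lastOf u L ≡ v × length L ≡ k
  fromPath record { vtx = f ; inj = inj ; start = refl ; end = end ; step = step } =
    tabulate (f ∘ suc) ,
    (linked-tabulate f step , AllPairs.tabulate⁺ (λ i≢j → i≢j ∘ inj)) ,
    trans (lastOf-tabulate f) end ,
    length-tabulate (f ∘ suc)

  prefix-ending-at : ∀ {x ys a} → a ∈ ys → SimplePath (x ∷ ys) →
    ∃[ h ] ∃[ L ] SimplePath (x ∷ h ∷ L) × lastOf h L ≡ a × h ∷ L ⊆ ys
  prefix-ending-at {ys = y ∷ ys} (here refl) (xy ∷ _ , x≢ ∷ _) =
    y , [] , (xy ∷ [-] , (All.head x≢ ∷ []) ∷ [] ∷ []) , refl , λ { (here e) → here e }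
  prefix-ending-at {ys = y ∷ ys} (there a∈) (xy ∷ linked , x≢ ∷ unique)
    with prefix-ending-at a∈ (linked , unique)
  ... | h , L , (linked′ , unique′) , end , sub =
    y , h ∷ L , (xy ∷ linked′ , anti-mono (∷⁺ʳ y sub) x≢ ∷ unique′) , end , ∷⁺ʳ y sub

  module Forest (acyclic : Acyclic G) where

    no-chord-to-start : ∀ {s b rest w} → SimplePath (s ∷ b ∷ rest) → w ∈ rest → ¬ (w ~ s)
    no-chord-to-start {s} {b} (sb ∷ linked , s≢ ∷ unique) w∈ ws with prefix-ending-at w∈ (linked , unique)
    ... | h , L , (linked′ , unique′) , refl , sub = acyclic record
      { len   = length (b ∷ h ∷ L)
      ; len≥2 = s≤s (s≤s z≤n)
      ; a     = s
      ; b     = lastOf h L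
      ; path  = toPath (sb ∷ linked′ , anti-mono (∷⁺ʳ _ sub) s≢ ∷ unique′)
      ; close = ws
      }

    extend : ∀ {w b a rest} → SimplePath (b ∷ a ∷ rest) → w ~ b → w ≢ a → SimplePath (w ∷ b ∷ a ∷ rest)
    extend p@(linked , unique) wb w≢a =
      wb ∷ linked ,
      (~-irrefl wb ∷ w≢a ∷ All.tabulate (λ t∈ w≡t → no-chord-to-start p (subst (_∈ _) (sym w≡t) t∈) wb))
        ∷ unique

    simplePath-unique : ∀ {s xs ys} → SimplePath (s ∷ xs) → SimplePath (s ∷ ys) →
      lastOf s xs ≡ lastOf s ys → xs ≡ ys
    simplePath-unique {xs = []}     {[]}     _             _             _ = refl
    simplePath-unique {xs = []}     {b ∷ ys} _             (_ , s≢ ∷ _) e =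
      ⊥-elim (All.lookup s≢ (lastOf∈ b ys) e)
    simplePath-unique {xs = a ∷ xs} {[]}     (_ , s≢ ∷ _) _             e =
      ⊥-elim (All.lookup s≢ (lastOf∈ a xs) (sym e))
    simplePath-unique {s} {a ∷ xs} {b ∷ ys} (sa ∷ linked , s≢ ∷ unique) q e with a ≟ b
    ... | yes refl = cong (a ∷_) (simplePath-unique (linked , unique) (tail q) e)
      where
      tail : SimplePath (s ∷ a ∷ ys) → SimplePath (a ∷ ys)
      tail (_ ∷ linked′ , _ ∷ unique′) = linked′ , unique′
    ... | no a≢b = ⊥-elim (All.lookup s≢ (there (subst (s ∈_) (sym xs≡sbys) (here refl))) refl)
      where
      -- a s b … ys is a second simple path from a to the common end, so s would recur in xs
      xs≡sbys : xs ≡ s ∷ b ∷ ys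
      xs≡sbys = simplePath-unique (linked , unique) (extend q (~-sym sa) a≢b) e

    path-length-unique : ∀ {u v j k} → Path G u v j → Path G u v k → j ≡ k
    path-length-unique P Q with fromPath P | fromPath Q
    ... | xs , p , refl , refl | ys , q , e , refl = cong length (simplePath-unique p q (sym e))

    path⇒dist : ∀ {u v k} → Path G u v k → Dist G u v k
    path⇒dist P = P , λ _ Q → ≤-reflexive (path-length-unique P Q)

module Supports (G : Graph) where
  open Graph G using (n; adj)
  open Counting G
  open SimplePaths G using (_~_)

  Support : Fin n → Set
  Support v = StrongSupport G v ⊎ WeakSupport G v

  isPendant⇒degree≡1 : ∀ {q} → isPendant G q ≡ true → degree G q ≡ 1
  isPendant⇒degree≡1 {q} pq = ≡ᵇ⇒≡ (degree G q) 1 (subst T (sym pq) tt)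

  support⇒pendant-nbr : ∀ {v} → Support v → ∃[ q ] v ~ q × degree G q ≡ 1
  support⇒pendant-nbr {v} s with count≡suc⇒∃true (λ u → adj v u ∧ isPendant G u) (positive s)
    where
    positive : ∀ {k} → 2 ≤ k ⊎ k ≡ 1 → k ≡ suc (pred k)
    positive (inj₁ (s≤s _)) = refl
    positive (inj₂ refl)    = refl
  ... | q , vq∧pq with ∧-≡true vq∧pq
  ...   | vq , pq = q , vq , isPendant⇒degree≡1 pq

  pendant-nbr⇒support : ∀ {v q} → v ~ q → degree G q ≡ 1 → Support v
  pendant-nbr⇒support {v} {q} vq d with true⇒count≡suc (λ u → adj v u ∧ isPendant G u) vq∧pq
    where
    vq∧pq : adj v q ∧ isPendant G q ≡ true
    vq∧pq rewrite vq = subst (λ k → (k ≡ᵇ 1) ≡ true) (sym d) refl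
  ... | zero  , e = inj₂ e
  ... | suc _ , e = inj₁ (subst (2 ≤_) (sym e) (s≤s (s≤s z≤n)))

module LongestPath (G : Graph) (acyclic : Acyclic G) (diam≤5 : ∀ u v k → Dist G u v k → k ≤ 5)
                   {s t : Fin (Graph.n G)} (P : Path G s t 5) where
  open Graph G using (n; adj)
  open Counting G
  open SimplePaths G
  open Forest acyclic
  open Path P using (vtx; inj; step)

  v₀ v₁ v₂ v₃ : Fin n
  v₀ = vtx zero
  v₁ = vtx (suc zero)
  v₂ = vtx (suc (suc zero))
  v₃ = vtx (suc (suc (suc zero)))

  simplePath-length≤5 : ∀ {x L} → SimplePath (x ∷ L) → length L ≤ 5
  simplePath-length≤5 p = diam≤5 _ _ _ (path⇒dist (toPath p))

  apart : ∀ {i j} → i ≢ j → vtx i ≢ vtx j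
  apart i≢j = i≢j ∘ inj

  v₃v₂v₁v₀ : SimplePath (v₃ ∷ v₂ ∷ v₁ ∷ v₀ ∷ [])
  v₃v₂v₁v₀ =
    ~-sym (step (suc (suc zero))) ∷ ~-sym (step (suc zero)) ∷ ~-sym (step zero) ∷ [-] ,
    (apart (λ ()) ∷ apart (λ ()) ∷ apart (λ ()) ∷ []) ∷
    (apart (λ ()) ∷ apart (λ ()) ∷ []) ∷ (apart (λ ()) ∷ []) ∷ [] ∷ []

  beyond-v₃-is-leaf : ∀ {u w} → v₃ ~ u → u ≢ v₂ → u ~ w → w ≢ v₃ → ∀ z → z ≢ u → adj w z ≡ false
  beyond-v₃-is-leaf {u} {w} v₃u u≢v₂ uw w≢v₃ z z≢u with adj w z in wz
  ... | false = refl
  ... | true  = ⊥-elim (n≮n 5 (simplePath-length≤5 zwuv₃v₂v₁v₀))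
    where
    zwuv₃v₂v₁v₀ : SimplePath (z ∷ w ∷ u ∷ v₃ ∷ v₂ ∷ v₁ ∷ v₀ ∷ [])
    zwuv₃v₂v₁v₀ = extend (extend (extend v₃v₂v₁v₀ (~-sym v₃u) u≢v₂) (~-sym uw) w≢v₃) (~-sym wz) z≢u

  degree-v₃≥2 : ∃[ k ] degree G v₃ ≡ suc (suc k)
  degree-v₃≥2 = true-at-two⇒count≡2+ (adj v₃) (~-sym (step (suc (suc zero)))) (step (suc (suc (suc zero))))
                  (apart λ ())

module MagicLabelings {c ℓ : Level} (A : AbelianGroup c ℓ) (G : Graph) where
  open AbelianGroup A renaming (Carrier to Γ; refl to ≈-refl; sym to ≈-sym; trans to ≈-trans)
  open Graph G using (n; adj)
  open Counting G
  open GroupSums A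
  open SimplePaths G using (_~_; ~-sym)
  open Supports G

  module _ (lab : Fin n → Γ) where

    weight-pendant : ∀ {q s} → degree G q ≡ 1 → q ~ s → weight A G lab q ≈ lab s
    weight-pendant {q} {s} d qs = ≈-trans (sumFin-single _ s off-s) on-s
      where
      off-s : ∀ u → u ≢ s → (if adj q u then lab u else ε) ≈ ε
      off-s u u≢s rewrite count≡1⇒false-elsewhere (adj q) d qs u u≢s = ≈-refl
      on-s : (if adj q s then lab s else ε) ≈ lab s
      on-s rewrite qs = ≈-refl

    weight-uniform : ∀ {v μ} → (∀ u → v ~ u → lab u ≈ μ) → weight A G lab v ≈ times A (degree G v) μ
    weight-uniform {v} = sumFin-masked-constant G (adj v) lab

    module _ {μ : Γ} (magic : ∀ v → weight A G lab v ≈ μ) where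

      pendant-nbr⇒label≈μ : ∀ {v q} → v ~ q → degree G q ≡ 1 → lab v ≈ μ
      pendant-nbr⇒label≈μ {q = q} vq d = ≈-trans (≈-sym (weight-pendant d (~-sym vq))) (magic q)

      support⇒label≈μ : ∀ {v} → Support v → lab v ≈ μ
      support⇒label≈μ s with support⇒pendant-nbr s
      ... | _ , vq , d = pendant-nbr⇒label≈μ vq d

      module _ (acyclic : Acyclic G) (diam≤5 : ∀ u v k → Dist G u v k → k ≤ 5)
               {s t : Fin n} (P : Path G s t 5) where
        open LongestPath G acyclic diam≤5 P

        nbr-of-v₃⇒label≈μ : Support v₂ → ¬ Support v₃ → ∀ u → v₃ ~ u → lab u ≈ μ
        nbr-of-v₃⇒label≈μ sup₂ nsup₃ u v₃u with u ≟ v₂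
        ... | yes refl = support⇒label≈μ sup₂
        ... | no u≢v₂ with degree G u ≟ℕ 1
        ...   | yes u-pendant = ⊥-elim (nsup₃ (pendant-nbr⇒support v₃u u-pendant))
        ...   | no u-inner with count≢1⇒true-elsewhere (adj u) (~-sym v₃u) u-inner
        ...     | w , w≢v₃ , uw =
          pendant-nbr⇒label≈μ uw
            (false-elsewhere⇒count≡1 (adj w) (~-sym uw) (beyond-v₃-is-leaf v₃u u≢v₂ uw w≢v₃))

theorem4p6 : ∀ {c ℓ : Level} (A : AbelianGroup c ℓ) → Infinite A → TorsionFree A →
    (T : Graph) → IsTree T → Diameter T 5 →
    (c1 c2 : Fin (Graph.n T)) → CentralPair T c1 c2 →
    (StrongSupport T c1 ⊎ WeakSupport T c1) →
    ¬ (StrongSupport T c2 ⊎ WeakSupport T c2) →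
    ¬ VertexMagic A T
theorem4p6 A _ torsionFree T (_ , acyclic) (_ , diam≤5) ._ ._ (_ , _ , P , refl , refl) sup₂ nsup₃
           (lab , nonzero , μ , magic) = nonzero v₂ (≈-trans (support⇒label≈μ lab magic sup₂) μ≈ε)
  where
  open AbelianGroup A using (_≈_; ε) renaming (sym to ≈-sym; trans to ≈-trans)
  open GroupSums A using (torsionFree-fixed⇒ε)
  open MagicLabelings A T
  open LongestPath T acyclic diam≤5 P using (v₂; v₃; degree-v₃≥2)

  degree-v₃·μ≈μ : times A (degree T v₃) μ ≈ μ
  degree-v₃·μ≈μ = ≈-trans (≈-sym (weight-uniform lab (nbr-of-v₃⇒label≈μ lab magic acyclic diam≤5 P sup₂ nsup₃)))
                          (magic v₃)

  μ≈ε : μ ≈ ε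
  μ≈ε with degree-v₃≥2
  ... | k , degree≡ = torsionFree-fixed⇒ε torsionFree k (subst (λ d → times A d μ ≈ μ) degree≡ degree-v₃·μ≈μ)
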